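{- For every finite multigraph $G=(V,E)$, $$T(G,x,y)=(x-1)^{ -k(E)}(y-1)^{ -|V|}\,\xi\big(G,(x-1)(y-1),\,y-1,\,0\big).$$
   Context: For $S\subseteq E$, $k(S)$ is the number of connected components of the spanning subgraph $(V,S)$, $V(S)$ the set of vertices covered by edges of $S$, and $k_{cov}(B)$ the number of connected components of $(V(B),B)$. Define $\xi(G,x,y,z)=\sum_{(A,B)} x^{k(A\cup B)-k_{cov}(B)} y^{|A|+|B|-k_{cov}(B)} z^{k_{cov}(B)}$, summing over pairs $A,B\subseteq E$ with $V(A)\cap V(B)=\emptyset$ (with $0^0=1$). The Tutte polynomial is $T(G,x,y)=\sum_{A\subseteq E}(x-1)^{k(A)-k(E)}(y-1)^{|A|+k(A)-|V|}$. -}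

module Defs where

open import Data.Nat as ℕ using (ℕ; zero; suc)
open import Data.Integer as ℤ using (ℤ; +_; -[1+_])
open import Data.Rational using (ℚ; 0ℚ; 1ℚ; _+_; _*_; _-_; 1/_; ≢-nonZero)
open import Data.Rational.Properties using (_≟_)
open import Data.Fin using (Fin; toℕ; _<_; _<?_)
open import Data.Fin.Subset using (Subset; _∪_; ∣_∣)
open import Data.Vec using (Vec; []; _∷_; lookup; replicate; tabulate)
open import Data.List using (List; []; _∷_; map; _++_; foldr; allFin)
open import Data.Bool using (Bool; true; false; _∨_; _∧_; not; if_then_else_)
open import Data.Product using (_×_; _,_; proj₁; proj₂)
open import Relation.Nullary using (yes; no)
open import Relation.Nullary.Decidable using (⌊_⌋)
open import Data.Fin using () renaming (_≟_ to _≟ᶠ_)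

-- A finite multigraph: vertex set Fin n, edge set Fin m, each edge has a
-- pair of (not necessarily distinct) endpoints.  Parallel edges and loops allowed.
record Multigraph : Set where
  field
    nV   : ℕ
    nE   : ℕ
    ends : Fin nE → Fin nV × Fin nV
open Multigraph public

Σℚ : {A : Set} → List A → (A → ℚ) → ℚ
Σℚ xs f = foldr (λ a s → f a + s) 0ℚ xs

_^ℕ_ : ℚ → ℕ → ℚ
a ^ℕ zero = 1ℚ
a ^ℕ suc k = a * (a ^ℕ k)

-- total inverse (0 ↦ 0); only ever applied to non-zero values in corollary1
inv : ℚ → ℚ
inv p with p ≟ 0ℚ
... | yes _ = 0ℚ
... | no p≢0 = 1/_ p {{≢-nonZero p≢0}}

_^ℤ_ : ℚ → ℤ → ℚ
a ^ℤ (+ k) = a ^ℕ k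
a ^ℤ -[1+ k ] = inv (a ^ℕ suc k)

allSubsets : (m : ℕ) → List (Subset m)
allSubsets zero = [] ∷ []
allSubsets (suc m) = map (true ∷_) (allSubsets m) ++ map (false ∷_) (allSubsets m)

module _ (G : Multigraph) where

  adjB : Subset (nE G) → Fin (nV G) → Fin (nV G) → Bool
  adjB S u v = foldr _∨_ false (map edgeJoins (allFin (nE G)))
    where
    edgeJoins : Fin (nE G) → Bool
    edgeJoins e = lookup S e ∧
      ((⌊ proj₁ (ends G e) ≟ᶠ u ⌋ ∧ ⌊ proj₂ (ends G e) ≟ᶠ v ⌋) ∨
       (⌊ proj₁ (ends G e) ≟ᶠ v ⌋ ∧ ⌊ proj₂ (ends G e) ≟ᶠ u ⌋))

  reachWithin : Subset (nE G) → ℕ → Fin (nV G) → Subset (nV G)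
  reachWithin S zero v = tabulate (λ u → ⌊ u ≟ᶠ v ⌋)
  reachWithin S (suc t) v =
    let R = reachWithin S t v in
    tabulate (λ u → lookup R u ∨
      foldr _∨_ false (map (λ w → lookup R w ∧ adjB S w u) (allFin (nV G))))

  -- connected component of v in the spanning subgraph (V,S)
  -- (every vertex of a component is reachable within |V| steps)
  component : Subset (nE G) → Fin (nV G) → Subset (nV G)
  component S v = reachWithin S (nV G) v

  isRepB : Subset (nE G) → Fin (nV G) → Bool
  isRepB S v = not (foldr _∨_ false
    (map (λ u → lookup (component S v) u ∧ ⌊ u <? v ⌋) (allFin (nV G))))

  countB : List Bool → ℕ
  countB = foldr (λ b n → if b then suc n else n) zero

  k : Subset (nE G) → ℕ
  k S = countB (map (isRepB S) (allFin (nV G)))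

  covered : Subset (nE G) → Subset (nV G)
  covered S = tabulate (λ v → foldr _∨_ false
    (map (λ e → lookup S e ∧ (⌊ proj₁ (ends G e) ≟ᶠ v ⌋ ∨ ⌊ proj₂ (ends G e) ≟ᶠ v ⌋))
         (allFin (nE G))))

  -- k_cov(B): number of connected components of (V(B),B).  A component of
  -- (V(B),B) is exactly a component of (V,B) contained in V(B).
  kcov : Subset (nE G) → ℕ
  kcov B = countB (map (λ v → lookup (covered B) v ∧ isRepB B v) (allFin (nV G)))

  disjointCoverB : Subset (nE G) → Subset (nE G) → Bool
  disjointCoverB A B = not (foldr _∨_ false
    (map (λ v → lookup (covered A) v ∧ lookup (covered B) v) (allFin (nV G))))

  -- the polynomial ξ(G,x,y,z), evaluated at rationals (0^0 = 1)
  ξ : ℚ → ℚ → ℚ → ℚ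
  ξ x y z = Σℚ (allSubsets (nE G)) λ A → Σℚ (allSubsets (nE G)) λ B →
    if disjointCoverB A B
    then (x ^ℤ (+ k (A ∪ B) ℤ.- + kcov B))
       * (y ^ℤ ((+ ∣ A ∣ ℤ.+ + ∣ B ∣) ℤ.- + kcov B))
       * (z ^ℕ kcov B)
    else 0ℚ

  Eall : Subset (nE G)
  Eall = tabulate (λ _ → true)

  T : ℚ → ℚ → ℚ
  T x y = Σℚ (allSubsets (nE G)) λ A →
    ((x - 1ℚ) ^ℤ (+ k A ℤ.- + k Eall))
    * ((y - 1ℚ) ^ℤ ((+ ∣ A ∣ ℤ.+ + k A) ℤ.- + nV G))

module Submission where

-- A pair (A,B) contributes z^(k_cov(B)) to ξ(G,x,y,z).  If B contains
-- an edge, then k_cov(B) ≥ 1: were k_cov(B) = 0, the least vertex covered by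
-- B would be the least vertex of its component (every vertex reachable from
-- it along B is covered), hence counted by k_cov(B).  So at z = 0 only B = ∅
-- survives, and as V(∅) = ∅ and k_cov(∅) = 0 we get
--   ξ(G,x,y,0) = Σ_A x^k(A) y^|A|.                                  (ξ-at-zero)
-- On the Tutte side, for a = x-1 ≠ 0 and b = y-1 ≠ 0 the exponent laws give
--   a^(k(A)-k(E)) b^(|A|+k(A)-|V|) = a^(-k(E)) b^(-|V|) (ab)^k(A) b^|A|,
-- and summing over A yields the theorem.

open import Defs
open import Data.Integer using (-_; +_)
open import Data.Rational using (ℚ; 0ℚ; 1ℚ; _*_; _-_)
open import Relation.Binary.PropositionalEquality using (_≡_; _≢_)

open import Algebra.Bundles using (CommutativeRing)
import Algebra.Properties.Group as GroupProperties
open import Data.Bool using (Bool; true; false; not; _∧_; _∨_; if_then_else_)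
open import Data.Bool.Properties using (∧-conicalˡ; ∧-conicalʳ; not-injective)
open import Data.Empty using (⊥-elim)
open import Data.Fin as Fin using (Fin; _<_; _≟_; _<?_)
open import Data.Fin.Induction using (<-wellFounded)
open import Data.Fin.Subset using (Subset; ⊥; _∪_; ∣_∣)
open import Data.Fin.Subset.Properties using (∪-identityʳ; ∣⊥∣≡0)
import Data.Integer as ℤ
import Data.Integer.Properties as ℤP
open import Data.List using (List; []; _∷_; _++_; map; allFin)
open import Data.Bool.ListAction using (any)
open import Data.List.Properties using (foldr-cong; foldr-map)
open import Data.List.Membership.Propositional using (_∈_)
open import Data.List.Membership.Propositional.Properties using (∈-allFin)
open import Data.List.Relation.Unary.Any using (here; there)
open import Data.Nat as ℕ using (ℕ; zero; suc)
import Data.Nat.Properties as ℕP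
open import Data.Product using (∃; _×_; _,_; proj₁; proj₂)
open import Data.Rational using (_+_; ≢-nonZero)
import Data.Rational.Properties as ℚP
open import Data.Rational.Solver using (module +-*-Solver)
open import Data.Sum using (_⊎_; inj₁; inj₂; [_,_]′)
open import Data.Vec as Vec using (lookup; tabulate)
open import Data.Vec.Properties using (lookup∘tabulate; lookup-replicate)
open import Function using (_∘_; case_of_)
open import Induction.WellFounded using (Acc; acc)
open import Relation.Nullary using (¬_; yes; no)
open import Relation.Nullary.Decidable using (Dec; ⌊_⌋)
open import Relation.Binary.PropositionalEquality
  using (refl; sym; trans; cong; cong₂; subst; ≡-≟-identity; module ≡-Reasoning)

open ≡-Reasoning

¬true⇒false : ∀ b → ¬ (b ≡ true) → b ≡ false
¬true⇒false true  b≢true = ⊥-elim (b≢true refl)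
¬true⇒false false _      = refl

isYes⇒witness : ∀ {P : Set} (p? : Dec P) → ⌊ p? ⌋ ≡ true → P
isYes⇒witness (yes p) _ = p
isYes⇒witness (no _) ()

any-witness : ∀ {A : Set} (f : A → Bool) (xs : List A) → any f xs ≡ true → ∃ λ x → f x ≡ true
any-witness f []       ()
any-witness f (x ∷ xs) h with f x in fx
... | true  = x , fx
... | false = any-witness f xs h

any-member : ∀ {A : Set} (f : A → Bool) {xs : List A} {x : A} → x ∈ xs → f x ≡ true → any f xs ≡ true
any-member f (here refl) fx rewrite fx = refl
any-member f {y ∷ _} (there x∈xs) fx with f y
... | true  = refl
... | false = any-member f x∈xs fx

joins⇒touches : ∀ b p q r s → b ∧ ((p ∧ q) ∨ (r ∧ s)) ≡ true → b ∧ (r ∨ q) ≡ true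
joins⇒touches false _     _     _     _ ()
joins⇒touches true  _     _     true  _ _ = refl
joins⇒touches true  _     true  false _ _ = refl
joins⇒touches true  true  false false _ ()
joins⇒touches true  false false false _ ()

module _ (G : Multigraph) where

  count≡0⇒none : ∀ {A : Set} (f : A → Bool) {xs : List A} {x : A} →
    x ∈ xs → countB G (map f xs) ≡ 0 → f x ≡ false
  count≡0⇒none f {y ∷ _} x∈xs h with f y in fy
  count≡0⇒none f {y ∷ _} x∈xs         () | true
  count≡0⇒none f {y ∷ _} (here refl)  h  | false = fy
  count≡0⇒none f {y ∷ _} (there x∈xs) h  | false = count≡0⇒none f x∈xs h

  none⇒count≡0 : ∀ {A : Set} (f : A → Bool) (xs : List A) →
    (∀ x → f x ≡ false) → countB G (map f xs) ≡ 0
  none⇒count≡0 f []       none = refl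
  none⇒count≡0 f (x ∷ xs) none rewrite none x = none⇒count≡0 f xs none

  touches : Subset (nE G) → Fin (nV G) → Fin (nE G) → Bool
  touches B u e = lookup B e ∧ (⌊ proj₁ (ends G e) ≟ u ⌋ ∨ ⌊ proj₂ (ends G e) ≟ u ⌋)

  covered-unfold : ∀ B u → lookup (covered G B) u ≡ any (touches B u) (allFin (nE G))
  covered-unfold B u = lookup∘tabulate (λ v → any (touches B v) (allFin (nE G))) u

  covered-intro : ∀ B u e → touches B u e ≡ true → lookup (covered G B) u ≡ true
  covered-intro B u e h = trans (covered-unfold B u) (any-member (touches B u) (∈-allFin e) h)

  covered-elim : ∀ B u → lookup (covered G B) u ≡ true → ∃ λ e → touches B u e ≡ true
  covered-elim B u h = any-witness (touches B u) (allFin (nE G)) (trans (sym (covered-unfold B u)) h)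

  endpoint-covered : ∀ B e → lookup B e ≡ true → lookup (covered G B) (proj₁ (ends G e)) ≡ true
  endpoint-covered B e h = covered-intro B _ e touch
    where
    touch : touches B (proj₁ (ends G e)) e ≡ true
    touch rewrite h | ≡-≟-identity _≟_ (refl {x = proj₁ (ends G e)}) = refl

  adjacent⇒covered : ∀ B w u → adjB G B w u ≡ true → lookup (covered G B) u ≡ true
  adjacent⇒covered B w u adj with any-witness _ (allFin (nE G)) adj
  ... | e , joins = covered-intro B u e
    (joins⇒touches (lookup B e) ⌊ proj₁ (ends G e) ≟ w ⌋ ⌊ proj₂ (ends G e) ≟ u ⌋
                   ⌊ proj₁ (ends G e) ≟ u ⌋ ⌊ proj₂ (ends G e) ≟ w ⌋ joins)

  -- One step of `reachWithin`: a newly reached vertex is adjacent to an old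
  -- one along B, hence covered by B.
  reach-step : ∀ B (R : Subset (nV G)) u →
    lookup (tabulate (λ u → lookup R u ∨ any (λ w → lookup R w ∧ adjB G B w u) (allFin (nV G)))) u ≡ true →
    lookup R u ≡ true ⊎ lookup (covered G B) u ≡ true
  reach-step B R u h
    rewrite lookup∘tabulate (λ u → lookup R u ∨ any (λ w → lookup R w ∧ adjB G B w u) (allFin (nV G))) u
    with lookup R u
  ... | true  = inj₁ refl
  ... | false with any-witness (λ w → lookup R w ∧ adjB G B w u) (allFin (nV G)) h
  ...   | w , step = inj₂ (adjacent⇒covered B w u (∧-conicalʳ (lookup R w) _ step))

  reach⇒covered : ∀ B t v u → lookup (reachWithin G B t v) u ≡ true →
    u ≡ v ⊎ lookup (covered G B) u ≡ true
  reach⇒covered B zero v u h =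
    inj₁ (isYes⇒witness (u ≟ v) (trans (sym (lookup∘tabulate (λ u → ⌊ u ≟ v ⌋) u)) h))
  reach⇒covered B (suc t) v u h =
    [ reach⇒covered B t v u , inj₂ ]′ (reach-step B (reachWithin G B t v) u h)

  non-least⇒smaller : ∀ B v → isRepB G B v ≡ false →
    ∃ λ u → u < v × lookup (component G B v) u ≡ true
  non-least⇒smaller B v not-least
    with any-witness (λ u → lookup (component G B v) u ∧ ⌊ u <? v ⌋) (allFin (nV G))
                     (not-injective {y = true} not-least)
  ... | u , h = u , isYes⇒witness (u <? v) (∧-conicalʳ (lookup (component G B v) u) _ h)
                  , ∧-conicalˡ (lookup (component G B v) u) _ h

  kcov≡0⇒covered-not-least : ∀ B → kcov G B ≡ 0 → ∀ v →
    lookup (covered G B) v ≡ true → isRepB G B v ≡ false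
  kcov≡0⇒covered-not-least B kcov≡0 v cov =
    subst (λ c → c ∧ isRepB G B v ≡ false) cov (count≡0⇒none _ (∈-allFin v) kcov≡0)

  -- If k_cov(B) = 0 then B covers no vertex: by well-founded induction on v,
  -- a covered v would have a smaller covered vertex in its component.
  kcov≡0⇒uncovered : ∀ B → kcov G B ≡ 0 → ∀ v → lookup (covered G B) v ≡ false
  kcov≡0⇒uncovered B kcov≡0 v = ¬true⇒false _ (uncovered v (<-wellFounded v))
    where
    uncovered : ∀ v → Acc _<_ v → ¬ (lookup (covered G B) v ≡ true)
    uncovered v (acc smaller) cov
      with u , u<v , u∈C ← non-least⇒smaller B v (kcov≡0⇒covered-not-least B kcov≡0 v cov)
      with reach⇒covered B (nV G) v u u∈C
    ... | inj₁ refl = ℕP.<-irrefl refl u<v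
    ... | inj₂ covu = uncovered u (smaller u<v) covu

  kcov-nonzero : ∀ B e → lookup B e ≡ true → kcov G B ≢ 0
  kcov-nonzero B e h kcov≡0 with () ← trans (sym (endpoint-covered B e h))
                                           (kcov≡0⇒uncovered B kcov≡0 (proj₁ (ends G e)))

  uncovered-∅ : ∀ v → lookup (covered G ⊥) v ≡ false
  uncovered-∅ v = ¬true⇒false _ λ cov →
    let e , touch = covered-elim ⊥ v cov in
    case trans (sym (lookup-replicate e false)) (∧-conicalˡ (lookup ⊥ e) _ touch) of λ ()

  kcov-∅ : kcov G ⊥ ≡ 0
  kcov-∅ = none⇒count≡0 _ (allFin (nV G)) λ v → cong (_∧ isRepB G ⊥ v) (uncovered-∅ v)

  disjoint-∅ : ∀ A → disjointCoverB G A ⊥ ≡ true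
  disjoint-∅ A = cong not (¬true⇒false _ λ shared →
    let v , both = any-witness _ (allFin (nV G)) shared in
    case trans (sym (uncovered-∅ v)) (∧-conicalʳ (lookup (covered G A) v) _ both) of λ ())

Σ-cong : ∀ {A : Set} (xs : List A) {f g : A → ℚ} → (∀ x → f x ≡ g x) → Σℚ xs f ≡ Σℚ xs g
Σ-cong xs f≗g = foldr-cong (λ x s → cong (_+ s) (f≗g x)) refl xs

Σ-map : ∀ {A B : Set} (g : A → B) (xs : List A) (f : B → ℚ) → Σℚ (map g xs) f ≡ Σℚ xs (λ x → f (g x))
Σ-map g xs f = foldr-map _ g 0ℚ xs

Σ-++ : ∀ {A : Set} (xs ys : List A) (f : A → ℚ) → Σℚ (xs ++ ys) f ≡ Σℚ xs f + Σℚ ys f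
Σ-++ []       ys f = sym (ℚP.+-identityˡ _)
Σ-++ (x ∷ xs) ys f = trans (cong (_+_ (f x)) (Σ-++ xs ys f)) (sym (ℚP.+-assoc (f x) _ _))

Σ-zero : ∀ {A : Set} (xs : List A) {f : A → ℚ} → (∀ x → f x ≡ 0ℚ) → Σℚ xs f ≡ 0ℚ
Σ-zero []       f≡0 = refl
Σ-zero (x ∷ xs) f≡0 rewrite f≡0 x | Σ-zero xs f≡0 = refl

Σ-*ˡ : ∀ {A : Set} (c : ℚ) (xs : List A) (f : A → ℚ) → c * Σℚ xs f ≡ Σℚ xs (λ x → c * f x)
Σ-*ˡ c []       f = ℚP.*-zeroʳ c
Σ-*ˡ c (x ∷ xs) f = trans (ℚP.*-distribˡ-+ c (f x) _) (cong (_+_ (c * f x)) (Σ-*ˡ c xs f))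

Σ-subsets-∅ : ∀ m (h : Subset m → ℚ) → (∀ B e → lookup B e ≡ true → h B ≡ 0ℚ) →
  Σℚ (allSubsets m) h ≡ h ⊥
Σ-subsets-∅ zero    h _        = ℚP.+-identityʳ _
Σ-subsets-∅ (suc m) h vanishes = begin
  Σℚ (map (true Vec.∷_) S ++ map (false Vec.∷_) S) h
    ≡⟨ Σ-++ (map (true Vec.∷_) S) _ h ⟩
  Σℚ (map (true Vec.∷_) S) h + Σℚ (map (false Vec.∷_) S) h
    ≡⟨ cong₂ _+_ (trans (Σ-map (true Vec.∷_) S h) (Σ-zero S λ B → vanishes (true Vec.∷ B) Fin.zero refl))
                 (Σ-map (false Vec.∷_) S h) ⟩
  0ℚ + Σℚ S (λ B → h (false Vec.∷ B))
    ≡⟨ ℚP.+-identityˡ _ ⟩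
  Σℚ S (λ B → h (false Vec.∷ B))
    ≡⟨ Σ-subsets-∅ m (λ B → h (false Vec.∷ B)) (λ B e → vanishes (false Vec.∷ B) (Fin.suc e)) ⟩
  h ⊥ ∎
  where
  S : List (Subset m)
  S = allSubsets m

-- Exponent laws.  Defs' power ^ℕ is the power of the semiring ℚ, so the
-- library laws for semiring exponentiation apply.

open CommutativeRing ℚP.+-*-commutativeRing using (commutativeSemiring)
import Algebra.Properties.CommutativeSemiring.Exp commutativeSemiring as Exp

^ℕ≡^ : ∀ a n → a ^ℕ n ≡ a Exp.^ n
^ℕ≡^ a zero    = refl
^ℕ≡^ a (suc n) = cong (a *_) (^ℕ≡^ a n)

^ℕ-+ : ∀ a m n → a ^ℕ (m ℕ.+ n) ≡ a ^ℕ m * a ^ℕ n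
^ℕ-+ a m n = begin
  a ^ℕ (m ℕ.+ n)          ≡⟨ ^ℕ≡^ a (m ℕ.+ n) ⟩
  a Exp.^ (m ℕ.+ n)       ≡⟨ Exp.^-homo-* a m n ⟩
  a Exp.^ m * a Exp.^ n   ≡⟨ sym (cong₂ _*_ (^ℕ≡^ a m) (^ℕ≡^ a n)) ⟩
  a ^ℕ m * a ^ℕ n         ∎

^ℕ-* : ∀ a b n → (a * b) ^ℕ n ≡ a ^ℕ n * b ^ℕ n
^ℕ-* a b n = begin
  (a * b) ^ℕ n            ≡⟨ ^ℕ≡^ (a * b) n ⟩
  (a * b) Exp.^ n         ≡⟨ Exp.^-distrib-* a b n ⟩
  a Exp.^ n * b Exp.^ n   ≡⟨ sym (cong₂ _*_ (^ℕ≡^ a n) (^ℕ≡^ b n)) ⟩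
  a ^ℕ n * b ^ℕ n         ∎

-- Positive powers of 0 vanish; this kills every term of ξ with k_cov(B) ≠ 0.
0^ℕ-nonzero : ∀ {n} → n ≢ 0 → 0ℚ ^ℕ n ≡ 0ℚ
0^ℕ-nonzero {zero}  n≢0 = ⊥-elim (n≢0 refl)
0^ℕ-nonzero {suc n} _   = ℚP.*-zeroˡ (0ℚ ^ℕ n)

inv-inverseˡ : ∀ {u} → u ≢ 0ℚ → inv u * u ≡ 1ℚ
inv-inverseˡ {u} u≢0 with u ℚP.≟ 0ℚ
... | yes u≡0 = ⊥-elim (u≢0 u≡0)
... | no  u≢0′ = ℚP.*-inverseˡ u {{≢-nonZero u≢0′}}

inv-unique : ∀ {u} w → u ≢ 0ℚ → w * u ≡ 1ℚ → w ≡ inv u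
inv-unique {u} w u≢0 wu≡1 = begin
  w                  ≡⟨ sym (ℚP.*-identityʳ w) ⟩
  w * 1ℚ             ≡⟨ cong (w *_) (sym (trans (ℚP.*-comm u (inv u)) (inv-inverseˡ u≢0))) ⟩
  w * (u * inv u)    ≡⟨ sym (ℚP.*-assoc w u (inv u)) ⟩
  (w * u) * inv u    ≡⟨ cong (_* inv u) wu≡1 ⟩
  1ℚ * inv u         ≡⟨ ℚP.*-identityˡ (inv u) ⟩
  inv u              ∎

*-≢0 : ∀ {a b} → a ≢ 0ℚ → b ≢ 0ℚ → a * b ≢ 0ℚ
*-≢0 {a} {b} a≢0 b≢0 ab≡0 = b≢0 (begin
  b                  ≡⟨ sym (ℚP.*-identityˡ b) ⟩
  1ℚ * b             ≡⟨ cong (_* b) (sym (inv-inverseˡ a≢0)) ⟩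
  (inv a * a) * b    ≡⟨ ℚP.*-assoc (inv a) a b ⟩
  inv a * (a * b)    ≡⟨ cong (inv a *_) ab≡0 ⟩
  inv a * 0ℚ         ≡⟨ ℚP.*-zeroʳ (inv a) ⟩
  0ℚ                 ∎)

^ℕ-≢0 : ∀ {a} → a ≢ 0ℚ → ∀ n → a ^ℕ n ≢ 0ℚ
^ℕ-≢0 a≢0 zero    ()
^ℕ-≢0 a≢0 (suc n) = *-≢0 a≢0 (^ℕ-≢0 a≢0 n)

^ℤ-neg : ∀ a n → a ^ℤ (- (+ n)) ≡ inv (a ^ℕ n)
^ℤ-neg a zero    = refl
^ℤ-neg a (suc n) = refl

^ℤ-diff : ∀ {a} → a ≢ 0ℚ → ∀ p q → a ^ℤ (+ p ℤ.- + q) ≡ a ^ℤ (- (+ q)) * a ^ℕ p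
^ℤ-diff {a} a≢0 p q = begin
  a ^ℤ (+ p ℤ.- + q)      ≡⟨ cong (a ^ℤ_) (ℤP.m-n≡m⊖n p q) ⟩
  a ^ℤ (p ℤ.⊖ q)          ≡⟨ ^ℤ-⊖ (ℕP.≤-total q p) ⟩
  a⁻q * a ^ℕ p            ≡⟨ cong (_* a ^ℕ p) (sym (^ℤ-neg a q)) ⟩
  a ^ℤ (- (+ q)) * a ^ℕ p ∎
  where
  a⁻q : ℚ
  a⁻q = inv (a ^ℕ q)

  a⁻q-cancel : ∀ d → a⁻q * a ^ℕ (q ℕ.+ d) ≡ a ^ℕ d
  a⁻q-cancel d = begin
    a⁻q * a ^ℕ (q ℕ.+ d)        ≡⟨ cong (a⁻q *_) (^ℕ-+ a q d) ⟩
    a⁻q * (a ^ℕ q * a ^ℕ d)     ≡⟨ sym (ℚP.*-assoc a⁻q _ _) ⟩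
    (a⁻q * a ^ℕ q) * a ^ℕ d     ≡⟨ cong (_* a ^ℕ d) (inv-inverseˡ (^ℕ-≢0 a≢0 q)) ⟩
    1ℚ * a ^ℕ d                 ≡⟨ ℚP.*-identityˡ _ ⟩
    a ^ℕ d                      ∎

  ^ℤ-⊖ : q ℕ.≤ p ⊎ p ℕ.≤ q → a ^ℤ (p ℤ.⊖ q) ≡ a⁻q * a ^ℕ p
  ^ℤ-⊖ (inj₁ q≤p) = begin
    a ^ℤ (p ℤ.⊖ q)              ≡⟨ cong (a ^ℤ_) (ℤP.⊖-≥ q≤p) ⟩
    a ^ℕ (p ℕ.∸ q)              ≡⟨ sym (a⁻q-cancel (p ℕ.∸ q)) ⟩
    a⁻q * a ^ℕ (q ℕ.+ (p ℕ.∸ q)) ≡⟨ cong (λ r → a⁻q * a ^ℕ r) (ℕP.m+[n∸m]≡n q≤p) ⟩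
    a⁻q * a ^ℕ p                ∎
  ^ℤ-⊖ (inj₂ p≤q) = begin
    a ^ℤ (p ℤ.⊖ q)              ≡⟨ cong (a ^ℤ_) (ℤP.⊖-≤ p≤q) ⟩
    a ^ℤ (- (+ d))              ≡⟨ ^ℤ-neg a d ⟩
    inv (a ^ℕ d)                ≡⟨ sym (inv-unique _ (^ℕ-≢0 a≢0 d) a⁻q·aᵖ·aᵈ≡1) ⟩
    a⁻q * a ^ℕ p                ∎
    where
    d : ℕ
    d = q ℕ.∸ p
    a⁻q·aᵖ·aᵈ≡1 : (a⁻q * a ^ℕ p) * a ^ℕ d ≡ 1ℚ
    a⁻q·aᵖ·aᵈ≡1 = begin
      (a⁻q * a ^ℕ p) * a ^ℕ d   ≡⟨ ℚP.*-assoc a⁻q _ _ ⟩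
      a⁻q * (a ^ℕ p * a ^ℕ d)   ≡⟨ cong (a⁻q *_) (sym (^ℕ-+ a p d)) ⟩
      a⁻q * a ^ℕ (p ℕ.+ d)      ≡⟨ cong (λ r → a⁻q * a ^ℕ r) (ℕP.m+[n∸m]≡n p≤q) ⟩
      a⁻q * a ^ℕ q              ≡⟨ inv-inverseˡ (^ℕ-≢0 a≢0 q) ⟩
      1ℚ                        ∎

exponent-split : ∀ {a b} → a ≢ 0ℚ → b ≢ 0ℚ → ∀ r s p q →
  a ^ℤ (+ r ℤ.- + s) * b ^ℤ (+ (p ℕ.+ r) ℤ.- + q)
    ≡ (a ^ℤ (- (+ s)) * b ^ℤ (- (+ q))) * ((a * b) ^ℕ r * b ^ℕ p)
exponent-split {a} {b} a≢0 b≢0 r s p q = begin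
  a ^ℤ (+ r ℤ.- + s) * b ^ℤ (+ (p ℕ.+ r) ℤ.- + q)
    ≡⟨ cong₂ _*_ (^ℤ-diff a≢0 r s) (^ℤ-diff b≢0 (p ℕ.+ r) q) ⟩
  (a⁻ˢ * a ^ℕ r) * (b⁻q * b ^ℕ (p ℕ.+ r))
    ≡⟨ cong (λ t → (a⁻ˢ * a ^ℕ r) * (b⁻q * t)) (^ℕ-+ b p r) ⟩
  (a⁻ˢ * a ^ℕ r) * (b⁻q * (b ^ℕ p * b ^ℕ r))
    ≡⟨ rearrange a⁻ˢ b⁻q (a ^ℕ r) (b ^ℕ r) (b ^ℕ p) ⟩
  (a⁻ˢ * b⁻q) * ((a ^ℕ r * b ^ℕ r) * b ^ℕ p)
    ≡⟨ cong (λ t → (a⁻ˢ * b⁻q) * (t * b ^ℕ p)) (sym (^ℕ-* a b r)) ⟩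
  (a⁻ˢ * b⁻q) * ((a * b) ^ℕ r * b ^ℕ p)
    ∎
  where
  a⁻ˢ b⁻q : ℚ
  a⁻ˢ = a ^ℤ (- (+ s))
  b⁻q = b ^ℤ (- (+ q))
  rearrange : ∀ u v x y z → (u * x) * (v * (z * y)) ≡ (u * v) * ((x * y) * z)
  rearrange = +-*-Solver.solve 5
    (λ u v x y z → (u :* x) :* (v :* (z :* y)) := (u :* v) :* ((x :* y) :* z)) refl
    where open +-*-Solver

ξ-weight : (G : Multigraph) → ℚ → ℚ → Subset (nE G) → Subset (nE G) → ℚ
ξ-weight G x y A B =
  (x ^ℤ (+ k G (A ∪ B) ℤ.- + kcov G B)) * (y ^ℤ ((+ ∣ A ∣ ℤ.+ + ∣ B ∣) ℤ.- + kcov G B))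

ξ-term : (G : Multigraph) → ℚ → ℚ → ℚ → Subset (nE G) → Subset (nE G) → ℚ
ξ-term G x y z A B =
  if disjointCoverB G A B then ξ-weight G x y A B * z ^ℕ kcov G B else 0ℚ

guarded-0^-vanishes : ∀ b u {n} → n ≢ 0 → (if b then u * 0ℚ ^ℕ n else 0ℚ) ≡ 0ℚ
guarded-0^-vanishes true  u n≢0 = trans (cong (u *_) (0^ℕ-nonzero n≢0)) (ℚP.*-zeroʳ u)
guarded-0^-vanishes false u _   = refl

ξ-term-vanishes : ∀ G x y A B e → lookup B e ≡ true → ξ-term G x y 0ℚ A B ≡ 0ℚ
ξ-term-vanishes G x y A B e e∈B =
  guarded-0^-vanishes (disjointCoverB G A B) (ξ-weight G x y A B) (kcov-nonzero G B e e∈B)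

ξ-term-∅ : ∀ G x y z A → ξ-term G x y z A ⊥ ≡ x ^ℕ k G A * y ^ℕ ∣ A ∣
ξ-term-∅ G x y z A
  rewrite disjoint-∅ G A | kcov-∅ G | ∪-identityʳ A | ∣⊥∣≡0 (nE G)
        | ℕP.+-identityʳ (k G A) | ℕP.+-identityʳ ∣ A ∣ | ℕP.+-identityʳ ∣ A ∣
  = ℚP.*-identityʳ _

ξ-at-zero : ∀ G x y → ξ G x y 0ℚ ≡ Σℚ (allSubsets (nE G)) (λ A → x ^ℕ k G A * y ^ℕ ∣ A ∣)
ξ-at-zero G x y = Σ-cong (allSubsets (nE G)) λ A →
  trans (Σ-subsets-∅ (nE G) (ξ-term G x y 0ℚ A) (ξ-term-vanishes G x y A))
        (ξ-term-∅ G x y 0ℚ A)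

x≢1⇒x-1≢0 : ∀ {x} → x ≢ 1ℚ → x - 1ℚ ≢ 0ℚ
x≢1⇒x-1≢0 {x} x≢1 = x≢1 ∘ x∙y⁻¹≈ε⇒x≈y x 1ℚ
  where open GroupProperties ℚP.+-0-group using (x∙y⁻¹≈ε⇒x≈y)

corollary1 : (G : Multigraph) (x y : ℚ) → x ≢ 1ℚ → y ≢ 1ℚ →
  T G x y ≡
    ((x - 1ℚ) ^ℤ (- (+ k G (Eall G)))) * ((y - 1ℚ) ^ℤ (- (+ nV G)))
      * ξ G ((x - 1ℚ) * (y - 1ℚ)) (y - 1ℚ) 0ℚ
corollary1 G x y x≢1 y≢1 = begin
  T G x y
    ≡⟨ Σ-cong subsets (λ A → exponent-split a≢0 b≢0 (k G A) (k G (Eall G)) ∣ A ∣ (nV G)) ⟩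
  Σℚ subsets (λ A → c * ((a * b) ^ℕ k G A * b ^ℕ ∣ A ∣))
    ≡⟨ sym (Σ-*ˡ c subsets _) ⟩
  c * Σℚ subsets (λ A → (a * b) ^ℕ k G A * b ^ℕ ∣ A ∣)
    ≡⟨ cong (c *_) (sym (ξ-at-zero G (a * b) b)) ⟩
  c * ξ G (a * b) b 0ℚ
    ∎
  where
  a b c : ℚ
  a = x - 1ℚ
  b = y - 1ℚ
  c = a ^ℤ (- (+ k G (Eall G))) * b ^ℤ (- (+ nV G))
  a≢0 : a ≢ 0ℚ
  a≢0 = x≢1⇒x-1≢0 x≢1
  b≢0 : b ≢ 0ℚ
  b≢0 = x≢1⇒x-1≢0 y≢1
  subsets : List (Subset (nE G))
  subsets = allSubsets (nE G)
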